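{- Let $\ell\ge1$, $0\le n\le k\le\ell$, $B=(b_1,\dots,b_\ell)$ with integers $b_i\ge2$, $A=A_{\ell,k;B}$. For $v'\in V'_{\ell,m;B}$ ($m\le k$) let $x_{v'}^{\ell k m}$ be the vector indexed by $V_{\ell,k;B}$ with $x_{v'}^{\ell k m}(w)=(-1)^{\ell-k}\nu_B(w,v')$, and $z_{v'}^{\ell m}$ the vector indexed by $\Sigma_B$ with $z_{v'}^{\ell m}(u)=\nu_B(u,v')$. Let $v'\in V'_{\ell,n;B}$. Then: (i) $A^{\top}x_{v'}^{\ell k n}=S_{\ell-k}(B(G_{v'}))\,z_{v'}^{\ell n}$; (ii) $A z_{v'}^{\ell n}=x_{v'}^{\ell k n}$; (iii) $AA^{\top}x_{v'}^{\ell k n}=S_{\ell-k}(B(G_{v'}))\,x_{v'}^{\ell k n}$; (iv) $A^{\top}A z_{v'}^{\ell n}=S_{\ell-k}(B(G_{v'}))\,z_{v'}^{\ell n}$; (v) for $0\le n_1,n_2\le k$ and any two distinct words $v\in V'_{\ell,n_1;B}$, $u\in V'_{\ell,n_2;B}$, the vectors $x_v^{\ell k n_1}$ and $x_u^{\ell k n_2}$ are orthogonal; (vi) for $0\le n_1,n_2\le k$ and any two distinct words $v\in V'_{\ell,n_1;B}$, $u\in V'_{\ell,n_2;B}$, the vectors $z_v^{\ell n_1}$ and $z_u^{\ell n_2}$ are orthogonal.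
   Context: For an integer $b\ge2$ let $\Sigma_b=\{0,\dots,b-1\}$, $\Delta_b=\Sigma_b\cup\{g\}$ ($g$ a gap symbol), $\Gamma_b=\Delta_b\setminus\{0\}$; $\Sigma_B=\prod_i\Sigma_{b_i}$, $\Delta_B=\prod_i\Delta_{b_i}$, $\Gamma_B=\prod_i\Gamma_{b_i}$, elements written as words. For $v\in\Delta_B$, $G_v=\{i:v_i=g\}$. $V_{\ell,k;B}=\{v\in\Delta_B:|G_v|=\ell-k\}$, $V'_{\ell,m;B}=\{v\in\Gamma_B:|G_v|=\ell-m\}$. For $X=\{x_1<\dots<x_n\}$, $B(X)=(b_{x_1},\dots,b_{x_n})$; $S_j$ is the $j$-th elementary symmetric polynomial ($S_0=1$). On $\Delta_{b_i}$ use the order $0\prec1\prec\cdots\prec b_i-1\prec g$ and define $\nu_i(x,y)=-b_i$ if $x=y=g$; $-y$ if $x=y\ne g$; $1$ if $x\prec y$; $0$ if $x\succ y$. $\nu_B(x,y)=\prod_{i=1}^\ell\nu_i(x_i,y_i)$. $u\in\Sigma_B$ and $v\in\Delta_B$ are matchable if $u_i=v_i$ whenever $v_i\ne g$. $A_{\ell,k;B}$ is the $(0,1)$-matrix with rows indexed by $V_{\ell,k;B}$, columns by $\Sigma_B$, with entry $1$ iff the indices are matchable. -}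

module Defs where

open import Data.Nat using (ℕ; zero; suc; _∸_; _<_)
open import Data.Fin using (Fin; toℕ)
open import Data.Maybe using (Maybe; just; nothing)
open import Data.Bool using (Bool; true; false; if_then_else_; _∧_)
open import Data.List using (List; []; _∷_; map; concatMap; filter; foldr)
open import Data.Vec using (Vec; []; _∷_)
open import Data.Integer using (ℤ; +_; -_; _+_; _*_; _^_; 0ℤ; 1ℤ; -1ℤ)
open import Data.Product using (_×_)
open import Data.Unit using (⊤)
open import Data.Empty using (⊥)
open import Relation.Nullary using (yes; no; ¬_)
open import Relation.Nullary.Decidable using (⌊_⌋)
open import Relation.Binary.PropositionalEquality using (_≡_)
import Data.Fin as F
import Data.Nat as N

-- A letter of Δ_b: `just d` is the digit d ∈ Σ_b = {0,…,b-1}; `nothing` is the gap g.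
Letter : ℕ → Set
Letter b = Maybe (Fin b)

data ΔWord : ∀ {ℓ} → Vec ℕ ℓ → Set where
  []  : ΔWord []
  _∷_ : ∀ {ℓ b} {B : Vec ℕ ℓ} → Letter b → ΔWord B → ΔWord (b ∷ B)

data ΣWord : ∀ {ℓ} → Vec ℕ ℓ → Set where
  []  : ΣWord []
  _∷_ : ∀ {ℓ b} {B : Vec ℕ ℓ} → Fin b → ΣWord B → ΣWord (b ∷ B)

embed : ∀ {ℓ} {B : Vec ℕ ℓ} → ΣWord B → ΔWord B
embed [] = []
embed (d ∷ u) = just d ∷ embed u

allLetters : (b : ℕ) → List (Letter b)
allLetters b = nothing ∷ map just (Data.List.allFin b)

allΔ : ∀ {ℓ} (B : Vec ℕ ℓ) → List (ΔWord B)
allΔ [] = [] ∷ []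
allΔ (b ∷ B) = concatMap (λ x → map (x ∷_) (allΔ B)) (allLetters b)

allΣ : ∀ {ℓ} (B : Vec ℕ ℓ) → List (ΣWord B)
allΣ [] = [] ∷ []
allΣ (b ∷ B) = concatMap (λ x → map (x ∷_) (allΣ B)) (Data.List.allFin b)

gapCount : ∀ {ℓ} {B : Vec ℕ ℓ} → ΔWord B → ℕ
gapCount [] = 0
gapCount (nothing ∷ v) = suc (gapCount v)
gapCount (just _ ∷ v) = gapCount v

gapBases : ∀ {ℓ} {B : Vec ℕ ℓ} → ΔWord B → List ℕ
gapBases [] = []
gapBases {B = b ∷ _} (nothing ∷ v) = b ∷ gapBases v
gapBases (just _ ∷ v) = gapBases v

InΓ : ∀ {ℓ} {B : Vec ℕ ℓ} → ΔWord B → Set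
InΓ [] = ⊤
InΓ (nothing ∷ v) = InΓ v
InΓ (just d ∷ v) = ¬ (toℕ d ≡ 0) × InΓ v

InV : ∀ {ℓ} {B : Vec ℕ ℓ} → ℕ → ΔWord B → Set
InV {ℓ} k v = gapCount v ≡ ℓ ∸ k

InV' : ∀ {ℓ} {B : Vec ℕ ℓ} → ℕ → ΔWord B → Set
InV' {ℓ} m v = InΓ v × gapCount v ≡ ℓ ∸ m

Vlist : ∀ {ℓ} (B : Vec ℕ ℓ) → ℕ → List (ΔWord B)
Vlist {ℓ} B k = filter (λ v → gapCount v N.≟ (ℓ ∸ k)) (allΔ B)

S : ℕ → List ℕ → ℕ
S zero _ = 1
S (suc j) [] = 0
S (suc j) (x ∷ xs) = x N.* S j xs N.+ S (suc j) xs

-- ν_i on Δ_{b}, order 0 ≺ 1 ≺ … ≺ b-1 ≺ g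
ν₁ : (b : ℕ) → Letter b → Letter b → ℤ
ν₁ b nothing nothing = - (+ b)
ν₁ b nothing (just _) = 0ℤ
ν₁ b (just _) nothing = 1ℤ
ν₁ b (just x) (just y) with toℕ x N.≟ toℕ y | toℕ x N.<? toℕ y
... | yes _ | _ = - (+ toℕ y)
... | no _ | yes _ = 1ℤ
... | no _ | no _ = 0ℤ

νB : ∀ {ℓ} {B : Vec ℕ ℓ} → ΔWord B → ΔWord B → ℤ
νB [] [] = 1ℤ
νB {B = b ∷ _} (x ∷ xs) (y ∷ ys) = ν₁ b x y * νB xs ys

matchable : ∀ {ℓ} {B : Vec ℕ ℓ} → ΣWord B → ΔWord B → Bool
matchable [] [] = true
matchable (d ∷ u) (nothing ∷ v) = matchable u v
matchable (d ∷ u) (just e ∷ v) = ⌊ d F.≟ e ⌋ ∧ matchable u v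

Aentry : ∀ {ℓ} {B : Vec ℕ ℓ} → ΔWord B → ΣWord B → ℤ
Aentry w u = if matchable u w then 1ℤ else 0ℤ

sumOver : ∀ {A : Set} → List A → (A → ℤ) → ℤ
sumOver xs f = foldr (λ a s → f a + s) 0ℤ xs

-- vectors indexed by V_{ℓ,k;B} (functions on Δ_B, only values on V_{ℓ,k;B} matter)
-- and vectors indexed by Σ_B
-- A^T x  (indexed by Σ_B)
AT : ∀ {ℓ} (B : Vec ℕ ℓ) (k : ℕ) → (ΔWord B → ℤ) → ΣWord B → ℤ
AT B k x u = sumOver (Vlist B k) (λ w → Aentry w u * x w)

Amul : ∀ {ℓ} (B : Vec ℕ ℓ) → (ΣWord B → ℤ) → ΔWord B → ℤ
Amul B z w = sumOver (allΣ B) (λ u → Aentry w u * z u)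

xvec : ∀ {ℓ} (B : Vec ℕ ℓ) (k : ℕ) → ΔWord B → ΔWord B → ℤ
xvec {ℓ} B k v' w = (-1ℤ ^ (ℓ ∸ k)) * νB w v'

zvec : ∀ {ℓ} (B : Vec ℕ ℓ) → ΔWord B → ΣWord B → ℤ
zvec B v' u = νB (embed u) v'

innerV : ∀ {ℓ} (B : Vec ℕ ℓ) (k : ℕ) → (ΔWord B → ℤ) → (ΔWord B → ℤ) → ℤ
innerV B k x y = sumOver (Vlist B k) (λ w → x w * y w)

innerΣ : ∀ {ℓ} (B : Vec ℕ ℓ) → (ΣWord B → ℤ) → (ΣWord B → ℤ) → ℤ
innerΣ B x y = sumOver (allΣ B) (λ u → x u * y u)

-- Everything factors over the positions of a word: an entry of A is a product of
-- one-letter matching weights, ν_B is the product of the ν_i, and both Σ_B and the words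
-- with j gaps split according to their first letter. Each identity therefore follows by
-- induction on ℓ from facts about the single matrix (ν(x, y)) with x, y ∈ Δ_b: the column of
-- a digit e sums to 0 over the digit rows (e ones, then −e, then zeros), the column of g sums
-- to b = −ν(g, g), and distinct columns are orthogonal, both over the digit rows and in the
-- gap row. In (i) the first letter of a row of V_{ℓ,k;B} is either a gap, of weight −b, or the
-- matching digit, which reproduces S_{j+1}(b, xs) = b S_j(xs) + S_{j+1}(xs) together with the
-- sign (−1)^j; (iii) and (iv) follow by composing (i) and (ii), and (v) and (vi) reduce
-- letter by letter to the orthogonality of distinct columns.

module Submission where

open import Defs
open import Data.Bool using (true; false; if_then_else_)
open import Data.Empty using (⊥-elim)
open import Data.Fin using (Fin; toℕ) renaming (zero to fzero; suc to fsuc)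
import Data.Fin.Properties as FP
open import Data.Integer using (ℤ; +_; -_; _+_; _*_; _^_; 0ℤ; 1ℤ; -1ℤ)
import Data.Integer.Properties as ZP
open import Data.Integer.Solver using (module +-*-Solver)
open import Data.List using (List; []; _∷_; _++_; map; filter; tabulate; concatMap; allFin)
open import Data.List.Properties using (foldr-map)
open import Data.Maybe using (just; nothing)
import Data.Maybe.Properties as MP
open import Data.Nat using (ℕ; zero; suc; _≤_; _∸_; s≤s; z≤n)
import Data.Nat as N
import Data.Nat.Properties as NP
open import Data.Product using (_×_; _,_)
open import Data.Vec using (Vec; []; _∷_)
open import Data.Vec.Relation.Unary.All using (All)
open import Relation.Binary.Definitions using (tri<; tri≈; tri>)
open import Relation.Binary.PropositionalEquality
  using (_≡_; _≢_; refl; sym; trans; cong; cong₂; module ≡-Reasoning)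
open import Relation.Nullary using (Dec; yes; no; does)
open import Relation.Nullary.Decidable using (⌊_⌋)
open import Relation.Unary using (Pred; Decidable)

open import Algebra.Properties.Semiring.Sum ZP.+-*-semiring
  using (sum-syntax; sum-cong-≗; sum-replicate-zero; *-distribˡ-sum; *-distribʳ-sum)

open import Algebra.Properties.CommutativeSemigroup ZP.*-commutativeSemigroup
  using () renaming (interchange to *-interchange; x∙yz≈y∙xz to x*yz≈y*xz)

open +-*-Solver using (solve; _:=_; _:+_; _:*_; :-_; con)
open ≡-Reasoning

*-zeroʳ-≡ : ∀ a {b} → b ≡ 0ℤ → a * b ≡ 0ℤ
*-zeroʳ-≡ a refl = ZP.*-zeroʳ a

*-zeroˡ-≡ : ∀ {a} b → a ≡ 0ℤ → a * b ≡ 0ℤ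
*-zeroˡ-≡ b refl = ZP.*-zeroˡ b

-1^n*-1^n≡1 : ∀ j → (-1ℤ ^ j) * (-1ℤ ^ j) ≡ 1ℤ
-1^n*-1^n≡1 zero    = refl
-1^n*-1^n≡1 (suc j) =
  trans (solve 1 (λ σ → (con -1ℤ :* σ) :* (con -1ℤ :* σ) := σ :* σ) refl (-1ℤ ^ j)) (-1^n*-1^n≡1 j)

sumOver-cong : ∀ {A : Set} (xs : List A) {f g : A → ℤ} →
  (∀ a → f a ≡ g a) → sumOver xs f ≡ sumOver xs g
sumOver-cong []       f≗g = refl
sumOver-cong (x ∷ xs) f≗g = cong₂ _+_ (f≗g x) (sumOver-cong xs f≗g)

sumOver-zero : ∀ {A : Set} (xs : List A) → sumOver xs (λ _ → 0ℤ) ≡ 0ℤ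
sumOver-zero []       = refl
sumOver-zero (x ∷ xs) = trans (ZP.+-identityˡ _) (sumOver-zero xs)

sumOver-*ˡ : ∀ {A : Set} (xs : List A) (c : ℤ) (f : A → ℤ) →
  sumOver xs (λ a → c * f a) ≡ c * sumOver xs f
sumOver-*ˡ []       c f = sym (ZP.*-zeroʳ c)
sumOver-*ˡ (x ∷ xs) c f =
  trans (cong (_+_ (c * f x)) (sumOver-*ˡ xs c f)) (sym (ZP.*-distribˡ-+ c (f x) _))

sumOver-++ : ∀ {A : Set} (xs ys : List A) (f : A → ℤ) →
  sumOver (xs ++ ys) f ≡ sumOver xs f + sumOver ys f
sumOver-++ []       ys f = sym (ZP.+-identityˡ _)
sumOver-++ (x ∷ xs) ys f = trans (cong (_+_ (f x)) (sumOver-++ xs ys f)) (sym (ZP.+-assoc (f x) _ _))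

sumOver-map : ∀ {A C : Set} (h : A → C) (xs : List A) (f : C → ℤ) →
  sumOver (map h xs) f ≡ sumOver xs (λ a → f (h a))
sumOver-map h xs f = foldr-map _ h 0ℤ xs

sumOver-concatMap : ∀ {A C : Set} (g : A → List C) (xs : List A) (f : C → ℤ) →
  sumOver (concatMap g xs) f ≡ sumOver xs (λ a → sumOver (g a) f)
sumOver-concatMap g []       f = refl
sumOver-concatMap g (x ∷ xs) f =
  trans (sumOver-++ (g x) _ f) (cong (_+_ (sumOver (g x) f)) (sumOver-concatMap g xs f))

sumOver-filter : ∀ {A : Set} {p} {P : Pred A p} (P? : Decidable P) (xs : List A) (f : A → ℤ) →
  sumOver (filter P? xs) f ≡ sumOver xs (λ a → if does (P? a) then f a else 0ℤ)
sumOver-filter P? []       f = refl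
sumOver-filter P? (x ∷ xs) f with does (P? x)
... | true  = cong (_+_ (f x)) (sumOver-filter P? xs f)
... | false = trans (sumOver-filter P? xs f) (sym (ZP.+-identityˡ _))

sumOver-filter-cong : ∀ {A : Set} {p} {P : Pred A p} (P? : Decidable P) (xs : List A) {f g : A → ℤ} →
  (∀ a → P a → f a ≡ g a) → sumOver (filter P? xs) f ≡ sumOver (filter P? xs) g
sumOver-filter-cong P? []       f≗g = refl
sumOver-filter-cong P? (x ∷ xs) f≗g with P? x
... | yes px = cong₂ _+_ (f≗g x px) (sumOver-filter-cong P? xs f≗g)
... | no  _  = sumOver-filter-cong P? xs f≗g

sumOver-tabulate : ∀ {A : Set} n (g : Fin n → A) (f : A → ℤ) →
  sumOver (tabulate g) f ≡ ∑[ i < n ] f (g i)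
sumOver-tabulate zero    g f = refl
sumOver-tabulate (suc n) g f = cong (_+_ (f (g fzero))) (sumOver-tabulate n (λ i → g (fsuc i)) f)

∑-one : ∀ n → ∑[ i < n ] 1ℤ ≡ + n
∑-one zero    = refl
∑-one (suc n) = cong (_+_ 1ℤ) (∑-one n)

∑-*ˡ : ∀ n (c : ℤ) (f : Fin n → ℤ) → ∑[ i < n ] (c * f i) ≡ c * ∑[ i < n ] f i
∑-*ˡ n c f = sym (*-distribˡ-sum c f)

∑-*ʳ : ∀ n (f : Fin n → ℤ) (c : ℤ) → ∑[ i < n ] (f i * c) ≡ (∑[ i < n ] f i) * c
∑-*ʳ n f c = sym (*-distribʳ-sum c f)

-- Sums over words, graded by the number of gaps

sumOver-allFin : ∀ n (f : Fin n → ℤ) → sumOver (allFin n) f ≡ ∑[ i < n ] f i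
sumOver-allFin n f = sumOver-tabulate n (λ i → i) f

sumOver-allΣ-∷ : ∀ {ℓ} b (B : Vec ℕ ℓ) (f : ΣWord (b ∷ B) → ℤ) →
  sumOver (allΣ (b ∷ B)) f ≡ ∑[ d < b ] sumOver (allΣ B) (λ u → f (d ∷ u))
sumOver-allΣ-∷ b B f = begin
  sumOver (allΣ (b ∷ B)) f
    ≡⟨ sumOver-concatMap _ (allFin b) f ⟩
  sumOver (allFin b) (λ d → sumOver (map (d ∷_) (allΣ B)) f)
    ≡⟨ sumOver-allFin b _ ⟩
  ∑[ d < b ] sumOver (map (d ∷_) (allΣ B)) f
    ≡⟨ sum-cong-≗ (λ d → sumOver-map (d ∷_) (allΣ B) f) ⟩
  ∑[ d < b ] sumOver (allΣ B) (λ u → f (d ∷ u)) ∎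

sumOver-allΔ-∷ : ∀ {ℓ} b (B : Vec ℕ ℓ) (f : ΔWord (b ∷ B) → ℤ) →
  sumOver (allΔ (b ∷ B)) f ≡
    sumOver (allΔ B) (λ w → f (nothing ∷ w)) + ∑[ e < b ] sumOver (allΔ B) (λ w → f (just e ∷ w))
sumOver-allΔ-∷ b B f = begin
  sumOver (allΔ (b ∷ B)) f
    ≡⟨ sumOver-concatMap (λ x → map (x ∷_) (allΔ B)) (allLetters b) f ⟩
  sumOver (map (nothing ∷_) (allΔ B)) f + sumOver (map just (allFin b)) inserted
    ≡⟨ cong₂ _+_ (sumOver-map (nothing ∷_) (allΔ B) f) (sumOver-map just (allFin b) inserted) ⟩
  sumOver (allΔ B) (λ w → f (nothing ∷ w)) + sumOver (allFin b) (λ e → inserted (just e))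
    ≡⟨ cong (_+_ (sumOver (allΔ B) (λ w → f (nothing ∷ w))))
            (trans (sumOver-allFin b _) (sum-cong-≗ (λ e → sumOver-map (just e ∷_) (allΔ B) f))) ⟩
  sumOver (allΔ B) (λ w → f (nothing ∷ w)) + ∑[ e < b ] sumOver (allΔ B) (λ w → f (just e ∷ w)) ∎
  where
  inserted : Letter b → ℤ
  inserted x = sumOver (map (x ∷_) (allΔ B)) f

sumGaps : ∀ {ℓ} (B : Vec ℕ ℓ) → ℕ → (ΔWord B → ℤ) → ℤ
sumGaps []      zero    f = f []
sumGaps []      (suc j) f = 0ℤ
sumGaps (b ∷ B) zero    f = ∑[ e < b ] sumGaps B zero (λ w → f (just e ∷ w))
sumGaps (b ∷ B) (suc j) f =
  sumGaps B j (λ w → f (nothing ∷ w)) + ∑[ e < b ] sumGaps B (suc j) (λ w → f (just e ∷ w))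

sumGaps-cong : ∀ {ℓ} (B : Vec ℕ ℓ) j {f g : ΔWord B → ℤ} →
  (∀ w → f w ≡ g w) → sumGaps B j f ≡ sumGaps B j g
sumGaps-cong []      zero    f≗g = f≗g []
sumGaps-cong []      (suc j) f≗g = refl
sumGaps-cong (b ∷ B) zero    f≗g = sum-cong-≗ (λ e → sumGaps-cong B zero (λ w → f≗g (just e ∷ w)))
sumGaps-cong (b ∷ B) (suc j) f≗g =
  cong₂ _+_ (sumGaps-cong B j (λ w → f≗g (nothing ∷ w)))
            (sum-cong-≗ (λ e → sumGaps-cong B (suc j) (λ w → f≗g (just e ∷ w))))

sumGaps-*ˡ : ∀ {ℓ} (B : Vec ℕ ℓ) j (c : ℤ) (f : ΔWord B → ℤ) →
  sumGaps B j (λ w → c * f w) ≡ c * sumGaps B j f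
sumGaps-*ˡ []      zero    c f = refl
sumGaps-*ˡ []      (suc j) c f = sym (ZP.*-zeroʳ c)
sumGaps-*ˡ (b ∷ B) zero    c f =
  trans (sum-cong-≗ (λ e → sumGaps-*ˡ B zero c (λ w → f (just e ∷ w))))
        (∑-*ˡ b c (λ e → sumGaps B zero (λ w → f (just e ∷ w))))
sumGaps-*ˡ (b ∷ B) (suc j) c f =
  trans (cong₂ _+_ (sumGaps-*ˡ B j c (λ w → f (nothing ∷ w)))
                   (trans (sum-cong-≗ (λ e → sumGaps-*ˡ B (suc j) c (λ w → f (just e ∷ w))))
                          (∑-*ˡ b c (λ e → sumGaps B (suc j) (λ w → f (just e ∷ w))))))
        (sym (ZP.*-distribˡ-+ c _ _))

sumOver-gapCount-filter : ∀ {ℓ} (B : Vec ℕ ℓ) j (f : ΔWord B → ℤ) →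
  sumOver (filter (λ v → gapCount v N.≟ j) (allΔ B)) f ≡ sumGaps B j f
sumOver-gapCount-filter B j f =
  trans (sumOver-filter (λ v → gapCount v N.≟ j) (allΔ B) f) (graded B j f)
  where
  graded : ∀ {ℓ} (B : Vec ℕ ℓ) j (f : ΔWord B → ℤ) →
    sumOver (allΔ B) (λ v → if does (gapCount v N.≟ j) then f v else 0ℤ) ≡ sumGaps B j f
  graded []      zero    f = ZP.+-identityʳ (f [])
  graded []      (suc j) f = refl
  graded (b ∷ B) zero    f =
    trans (sumOver-allΔ-∷ b B (λ v → if does (gapCount v N.≟ zero) then f v else 0ℤ))
      (trans (cong₂ _+_ (sumOver-zero (allΔ B))
                        (sum-cong-≗ (λ e → graded B zero (λ w → f (just e ∷ w)))))
             (ZP.+-identityˡ _))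
  graded (b ∷ B) (suc j) f =
    trans (sumOver-allΔ-∷ b B (λ v → if does (gapCount v N.≟ suc j) then f v else 0ℤ))
      (cong₂ _+_ (graded B j (λ w → f (nothing ∷ w)))
                 (sum-cong-≗ (λ e → graded B (suc j) (λ w → f (just e ∷ w)))))

sumOver-allΣ-∷-factor : ∀ {ℓ b} (B : Vec ℕ ℓ) (f : ΣWord (b ∷ B) → ℤ) (φ : Fin b → ℤ) (g : ΣWord B → ℤ) →
  (∀ d u → f (d ∷ u) ≡ φ d * g u) → sumOver (allΣ (b ∷ B)) f ≡ (∑[ d < b ] φ d) * sumOver (allΣ B) g
sumOver-allΣ-∷-factor {b = b} B f φ g f≡φg = begin
  sumOver (allΣ (b ∷ B)) f                          ≡⟨ sumOver-allΣ-∷ b B f ⟩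
  ∑[ d < b ] sumOver (allΣ B) (λ u → f (d ∷ u))     ≡⟨ sum-cong-≗ (λ d → sumOver-cong (allΣ B) (f≡φg d)) ⟩
  ∑[ d < b ] sumOver (allΣ B) (λ u → φ d * g u)     ≡⟨ sum-cong-≗ (λ d → sumOver-*ˡ (allΣ B) (φ d) g) ⟩
  ∑[ d < b ] (φ d * sumOver (allΣ B) g)             ≡⟨ ∑-*ʳ b φ _ ⟩
  (∑[ d < b ] φ d) * sumOver (allΣ B) g             ∎

∑-sumGaps-factor : ∀ {ℓ b} (B : Vec ℕ ℓ) j (f : ΔWord (b ∷ B) → ℤ) (φ : Letter b → ℤ) (g : ΔWord B → ℤ) →
  (∀ x w → f (x ∷ w) ≡ φ x * g w) →
  ∑[ e < b ] sumGaps B j (λ w → f (just e ∷ w)) ≡ (∑[ e < b ] φ (just e)) * sumGaps B j g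
∑-sumGaps-factor {b = b} B j f φ g f≡φg =
  trans (sum-cong-≗ (λ e → trans (sumGaps-cong B j (f≡φg (just e))) (sumGaps-*ˡ B j (φ (just e)) g)))
        (∑-*ʳ b (λ e → φ (just e)) _)

sumGaps-∷-zero : ∀ {ℓ b} (B : Vec ℕ ℓ) (f : ΔWord (b ∷ B) → ℤ) (φ : Letter b → ℤ) (g : ΔWord B → ℤ) →
  (∀ x w → f (x ∷ w) ≡ φ x * g w) →
  sumGaps (b ∷ B) zero f ≡ (∑[ e < b ] φ (just e)) * sumGaps B zero g
sumGaps-∷-zero B = ∑-sumGaps-factor B zero

sumGaps-∷-suc : ∀ {ℓ b} (B : Vec ℕ ℓ) j (f : ΔWord (b ∷ B) → ℤ) (φ : Letter b → ℤ) (g : ΔWord B → ℤ) →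
  (∀ x w → f (x ∷ w) ≡ φ x * g w) →
  sumGaps (b ∷ B) (suc j) f ≡ φ nothing * sumGaps B j g + (∑[ e < b ] φ (just e)) * sumGaps B (suc j) g
sumGaps-∷-suc B j f φ g f≡φg =
  cong₂ _+_ (trans (sumGaps-cong B j (f≡φg nothing)) (sumGaps-*ˡ B j (φ nothing) g))
            (∑-sumGaps-factor B (suc j) f φ g f≡φg)

sumGaps-∷-vanishʳ : ∀ {ℓ b} (B : Vec ℕ ℓ) j (f : ΔWord (b ∷ B) → ℤ) (φ : Letter b → ℤ) (g : ΔWord B → ℤ) →
  (∀ x w → f (x ∷ w) ≡ φ x * g w) → (∀ j → sumGaps B j g ≡ 0ℤ) → sumGaps (b ∷ B) j f ≡ 0ℤ
sumGaps-∷-vanishʳ {b = b} B zero f φ g f≡φg g≡0 =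
  trans (sumGaps-∷-zero B f φ g f≡φg) (*-zeroʳ-≡ (∑[ e < b ] φ (just e)) (g≡0 zero))
sumGaps-∷-vanishʳ {b = b} B (suc j) f φ g f≡φg g≡0 =
  trans (sumGaps-∷-suc B j f φ g f≡φg)
        (cong₂ _+_ (*-zeroʳ-≡ (φ nothing) (g≡0 j)) (*-zeroʳ-≡ (∑[ e < b ] φ (just e)) (g≡0 (suc j))))

sumGaps-∷-vanishˡ : ∀ {ℓ b} (B : Vec ℕ ℓ) j (f : ΔWord (b ∷ B) → ℤ) (φ : Letter b → ℤ) (g : ΔWord B → ℤ) →
  (∀ x w → f (x ∷ w) ≡ φ x * g w) → φ nothing ≡ 0ℤ → ∑[ e < b ] φ (just e) ≡ 0ℤ →
  sumGaps (b ∷ B) j f ≡ 0ℤ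
sumGaps-∷-vanishˡ B zero f φ g f≡φg φg≡0 φd≡0 =
  trans (sumGaps-∷-zero B f φ g f≡φg) (*-zeroˡ-≡ (sumGaps B zero g) φd≡0)
sumGaps-∷-vanishˡ B (suc j) f φ g f≡φg φg≡0 φd≡0 =
  trans (sumGaps-∷-suc B j f φ g f≡φg)
        (cong₂ _+_ (*-zeroˡ-≡ (sumGaps B j g) φg≡0) (*-zeroˡ-≡ (sumGaps B (suc j) g) φd≡0))

-- One letter

matchWeight : ∀ {b} → Letter b → Fin b → ℤ
matchWeight nothing  d = 1ℤ
matchWeight (just e) d = if ⌊ d FP.≟ e ⌋ then 1ℤ else 0ℤ

Aentry-∷ : ∀ {ℓ b} {B : Vec ℕ ℓ} (x : Letter b) (w : ΔWord B) (d : Fin b) (u : ΣWord B) →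
  Aentry (x ∷ w) (d ∷ u) ≡ matchWeight x d * Aentry w u
Aentry-∷ nothing  w d u = sym (ZP.*-identityˡ _)
Aentry-∷ (just e) w d u with ⌊ d FP.≟ e ⌋ | matchable u w
... | true  | true  = refl
... | true  | false = refl
... | false | _     = refl

Aentry-∷-* : ∀ {ℓ b} {B : Vec ℕ ℓ} (x : Letter b) (w : ΔWord B) (d : Fin b) (u : ΣWord B) (m n : ℤ) →
  Aentry (x ∷ w) (d ∷ u) * (m * n) ≡ (matchWeight x d * m) * (Aentry w u * n)
Aentry-∷-* x w d u m n =
  trans (cong (_* (m * n)) (Aentry-∷ x w d u)) (*-interchange (matchWeight x d) (Aentry w u) m n)

matchWeight-suc : ∀ {b} (e d : Fin b) → matchWeight (just (fsuc e)) (fsuc d) ≡ matchWeight (just e) d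
matchWeight-suc e d with d FP.≟ e
... | yes _ = refl
... | no  _ = refl

matchWeight-sym : ∀ {b} (e d : Fin b) → matchWeight (just e) d ≡ matchWeight (just d) e
matchWeight-sym e d with d FP.≟ e | e FP.≟ d
... | yes _   | yes _   = refl
... | no  _   | no  _   = refl
... | yes d≡e | no  e≢d = ⊥-elim (e≢d (sym d≡e))
... | no  d≢e | yes e≡d = ⊥-elim (d≢e (sym e≡d))

∑-matchWeight : ∀ b (e : Fin b) (h : Fin b → ℤ) → ∑[ d < b ] (matchWeight (just e) d * h d) ≡ h e
∑-matchWeight (suc b) fzero h = begin
  1ℤ * h fzero + ∑[ d < b ] (0ℤ * h (fsuc d))
    ≡⟨ cong₂ _+_ (ZP.*-identityˡ (h fzero)) (sum-cong-≗ (λ d → ZP.*-zeroˡ (h (fsuc d)))) ⟩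
  h fzero + ∑[ d < b ] 0ℤ
    ≡⟨ cong (_+_ (h fzero)) (sum-replicate-zero b) ⟩
  h fzero + 0ℤ
    ≡⟨ ZP.+-identityʳ _ ⟩
  h fzero ∎
∑-matchWeight (suc b) (fsuc e) h = begin
  0ℤ * h fzero + ∑[ d < b ] (matchWeight (just (fsuc e)) (fsuc d) * h (fsuc d))
    ≡⟨ cong₂ _+_ (ZP.*-zeroˡ (h fzero)) (sum-cong-≗ (λ d → cong (_* h (fsuc d)) (matchWeight-suc e d))) ⟩
  0ℤ + ∑[ d < b ] (matchWeight (just e) d * h (fsuc d))
    ≡⟨ ZP.+-identityˡ _ ⟩
  ∑[ d < b ] (matchWeight (just e) d * h (fsuc d))
    ≡⟨ ∑-matchWeight b e (λ d → h (fsuc d)) ⟩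
  h (fsuc e) ∎

∑-matchWeight-swapped : ∀ b (d : Fin b) (h : Fin b → ℤ) → ∑[ e < b ] (matchWeight (just e) d * h e) ≡ h d
∑-matchWeight-swapped b d h =
  trans (sum-cong-≗ (λ e → cong (_* h e) (matchWeight-sym e d))) (∑-matchWeight b d h)

ν₁-< : ∀ {b} {d e : Fin b} → toℕ d N.< toℕ e → ν₁ b (just d) (just e) ≡ 1ℤ
ν₁-< {d = d} {e} d<e with toℕ d N.≟ toℕ e | toℕ d N.<? toℕ e
... | yes d≡e | _       = ⊥-elim (NP.<-irrefl d≡e d<e)
... | no  _   | yes _   = refl
... | no  _   | no  d≮e = ⊥-elim (d≮e d<e)

ν₁-≡ : ∀ {b} {d e : Fin b} → toℕ d ≡ toℕ e → ν₁ b (just d) (just e) ≡ - + toℕ e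
ν₁-≡ {d = d} {e} d≡e with toℕ d N.≟ toℕ e | toℕ d N.<? toℕ e
... | yes _   | _ = refl
... | no  d≢e | _ = ⊥-elim (d≢e d≡e)

ν₁-> : ∀ {b} {d e : Fin b} → toℕ e N.< toℕ d → ν₁ b (just d) (just e) ≡ 0ℤ
ν₁-> {d = d} {e} e<d with toℕ d N.≟ toℕ e | toℕ d N.<? toℕ e
... | yes d≡e | _       = ⊥-elim (NP.<-irrefl (sym d≡e) e<d)
... | no  _   | yes d<e = ⊥-elim (NP.<-asym d<e e<d)
... | no  _   | no  _   = refl

∑-steps : ∀ b m (g : Fin b → ℤ) (α β : ℤ) → m N.< b →
  (∀ d → toℕ d N.< m → g d ≡ α) → (∀ d → toℕ d ≡ m → g d ≡ β) →
  (∀ d → m N.< toℕ d → g d ≡ 0ℤ) → ∑[ d < b ] g d ≡ + m * α + β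
∑-steps (suc b) zero g α β _ g<m g≡m g>m = begin
  g fzero + ∑[ d < b ] g (fsuc d)
    ≡⟨ cong₂ _+_ (g≡m fzero refl) (sum-cong-≗ (λ d → g>m (fsuc d) (s≤s z≤n))) ⟩
  β + ∑[ d < b ] 0ℤ
    ≡⟨ cong (_+_ β) (sum-replicate-zero b) ⟩
  β + 0ℤ
    ≡⟨ solve 2 (λ α β → β :+ con 0ℤ := con 0ℤ :* α :+ β) refl α β ⟩
  0ℤ * α + β ∎
∑-steps (suc b) (suc m) g α β (s≤s m<b) g<m g≡m g>m = begin
  g fzero + ∑[ d < b ] g (fsuc d)
    ≡⟨ cong₂ _+_ (g<m fzero (s≤s z≤n))
                 (∑-steps b m (λ d → g (fsuc d)) α β m<b (λ d d<m → g<m (fsuc d) (s≤s d<m))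
                    (λ d d≡m → g≡m (fsuc d) (cong suc d≡m)) (λ d m<d → g>m (fsuc d) (s≤s m<d))) ⟩
  α + (+ m * α + β)
    ≡⟨ solve 3 (λ α m β → α :+ (m :* α :+ β) := (con 1ℤ :+ m) :* α :+ β) refl α (+ m) β ⟩
  + suc m * α + β ∎

∑-ν₁-column : ∀ b (e : Fin b) → ∑[ d < b ] ν₁ b (just d) (just e) ≡ 0ℤ
∑-ν₁-column b e =
  trans (∑-steps b (toℕ e) _ 1ℤ (- + toℕ e) (FP.toℕ<n e) (λ d → ν₁-<) (λ d → ν₁-≡) (λ d → ν₁->))
        (solve 1 (λ m → m :* con 1ℤ :+ (:- m) := con 0ℤ) refl (+ toℕ e))

∑-ν₁ : ∀ b (y : Letter b) → ∑[ d < b ] ν₁ b (just d) y ≡ - ν₁ b nothing y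
∑-ν₁ b nothing  = trans (∑-one b) (sym (ZP.neg-involutive (+ b)))
∑-ν₁ b (just e) = ∑-ν₁-column b e

∑-ν₁-column-below : ∀ b (e : Fin b) (y : Letter b) →
  (∀ d → toℕ d N.≤ toℕ e → ν₁ b (just d) y ≡ 1ℤ) →
  ∑[ d < b ] (ν₁ b (just d) (just e) * ν₁ b (just d) y) ≡ 0ℤ
∑-ν₁-column-below b e y below = trans (sum-cong-≗ drop-y) (∑-ν₁-column b e)
  where
  drop-y : ∀ d → ν₁ b (just d) (just e) * ν₁ b (just d) y ≡ ν₁ b (just d) (just e)
  drop-y d with toℕ d N.≤? toℕ e
  ... | yes d≤e = trans (cong (ν₁ b (just d) (just e) *_) (below d d≤e)) (ZP.*-identityʳ _)
  ... | no  d≰e = trans (cong (_* ν₁ b (just d) y) (ν₁-> (NP.≰⇒> d≰e)))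
                        (trans (ZP.*-zeroˡ (ν₁ b (just d) y)) (sym (ν₁-> (NP.≰⇒> d≰e))))

∑-ν₁-orthogonal : ∀ b (x y : Letter b) → x ≢ y → ∑[ d < b ] (ν₁ b (just d) x * ν₁ b (just d) y) ≡ 0ℤ
∑-ν₁-orthogonal b nothing  nothing  x≢y = ⊥-elim (x≢y refl)
∑-ν₁-orthogonal b nothing  (just f) x≢y =
  trans (sum-cong-≗ (λ d → ZP.*-comm (ν₁ b (just d) nothing) _)) (∑-ν₁-column-below b f nothing (λ _ _ → refl))
∑-ν₁-orthogonal b (just e) nothing  x≢y = ∑-ν₁-column-below b e nothing (λ _ _ → refl)
∑-ν₁-orthogonal b (just e) (just f) x≢y with NP.<-cmp (toℕ e) (toℕ f)
... | tri< e<f _ _ = ∑-ν₁-column-below b e (just f) (λ d d≤e → ν₁-< (NP.≤-<-trans d≤e e<f))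
... | tri≈ _ e≡f _ = ⊥-elim (x≢y (cong just (FP.toℕ-injective e≡f)))
... | tri> _ _ f<e =
  trans (sum-cong-≗ (λ d → ZP.*-comm (ν₁ b (just d) (just e)) _))
        (∑-ν₁-column-below b f (just e) (λ d d≤f → ν₁-< (NP.≤-<-trans d≤f f<e)))

ν₁-gap-orthogonal : ∀ b (x y : Letter b) → x ≢ y → ν₁ b nothing x * ν₁ b nothing y ≡ 0ℤ
ν₁-gap-orthogonal b nothing  nothing  x≢y = ⊥-elim (x≢y refl)
ν₁-gap-orthogonal b nothing  (just f) x≢y = ZP.*-zeroʳ (- + b)
ν₁-gap-orthogonal b (just e) y        x≢y = ZP.*-zeroˡ (ν₁ b nothing y)

+S-∷ : ∀ b j xs → + S (suc j) (b ∷ xs) ≡ + b * + S j xs + + S (suc j) xs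
+S-∷ b j xs = trans (ZP.pos-+ (b N.* S j xs) _) (cong (_+ + S (suc j) xs) (ZP.pos-* b (S j xs)))

sumGaps-Aentry-νB : ∀ {ℓ} (B : Vec ℕ ℓ) j (u : ΣWord B) (v : ΔWord B) →
  sumGaps B j (λ w → Aentry w u * νB w v) ≡ ((-1ℤ ^ j) * + S j (gapBases v)) * νB (embed u) v
sumGaps-Aentry-νB []      zero    []      []      = refl
sumGaps-Aentry-νB []      (suc j) []      []      = sym (cong (_* 1ℤ) (ZP.*-zeroʳ (-1ℤ ^ suc j)))
sumGaps-Aentry-νB (b ∷ B) zero    (d ∷ u) (y ∷ v) = begin
  sumGaps (b ∷ B) zero F
    ≡⟨ sumGaps-∷-zero B F (λ x → matchWeight x d * ν₁ b x y) G (λ x w → Aentry-∷-* x w d u _ _) ⟩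
  (∑[ e < b ] (matchWeight (just e) d * ν₁ b (just e) y)) * sumGaps B zero G
    ≡⟨ cong₂ _*_ (∑-matchWeight-swapped b d (λ e → ν₁ b (just e) y)) (sumGaps-Aentry-νB B zero u v) ⟩
  ν₁ b (just d) y * (1ℤ * z)
    ≡⟨ x*yz≈y*xz (ν₁ b (just d) y) 1ℤ z ⟩
  1ℤ * (ν₁ b (just d) y * z) ∎
  where
  F = λ w → Aentry w (d ∷ u) * νB w (y ∷ v)
  G = λ w → Aentry w u * νB w v
  z = νB (embed u) v
sumGaps-Aentry-νB (b ∷ B) (suc j) (d ∷ u) (nothing ∷ v) = begin
  sumGaps (b ∷ B) (suc j) F
    ≡⟨ sumGaps-∷-suc B j F (λ x → matchWeight x d * ν₁ b x nothing) G (λ x w → Aentry-∷-* x w d u _ _) ⟩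
  (1ℤ * - + b) * sumGaps B j G + (∑[ e < b ] (matchWeight (just e) d * 1ℤ)) * sumGaps B (suc j) G
    ≡⟨ cong₂ _+_ (cong (_*_ (1ℤ * - + b)) (sumGaps-Aentry-νB B j u v))
                 (cong₂ _*_ (∑-matchWeight-swapped b d (λ _ → 1ℤ)) (sumGaps-Aentry-νB B (suc j) u v)) ⟩
  (1ℤ * - + b) * ((σ * s) * z) + 1ℤ * (((-1ℤ * σ) * s′) * z)
    ≡⟨ solve 5 (λ b σ s s′ z → (con 1ℤ :* (:- b)) :* ((σ :* s) :* z) :+ con 1ℤ :* (((con -1ℤ :* σ) :* s′) :* z)
                             := ((con -1ℤ :* σ) :* (b :* s :+ s′)) :* (con 1ℤ :* z)) refl (+ b) σ s s′ z ⟩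
  ((-1ℤ * σ) * (+ b * s + s′)) * (1ℤ * z)
    ≡⟨ cong (λ t → ((-1ℤ * σ) * t) * (1ℤ * z)) (sym (+S-∷ b j (gapBases v))) ⟩
  ((-1ℤ * σ) * + S (suc j) (b ∷ gapBases v)) * (1ℤ * z) ∎
  where
  F = λ w → Aentry w (d ∷ u) * νB w (nothing ∷ v)
  G = λ w → Aentry w u * νB w v
  σ = -1ℤ ^ j
  s = + S j (gapBases v)
  s′ = + S (suc j) (gapBases v)
  z = νB (embed u) v
sumGaps-Aentry-νB (b ∷ B) (suc j) (d ∷ u) (just f ∷ v) = begin
  sumGaps (b ∷ B) (suc j) F
    ≡⟨ sumGaps-∷-suc B j F (λ x → matchWeight x d * ν₁ b x (just f)) G (λ x w → Aentry-∷-* x w d u _ _) ⟩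
  0ℤ * sumGaps B j G + (∑[ e < b ] (matchWeight (just e) d * ν₁ b (just e) (just f))) * sumGaps B (suc j) G
    ≡⟨ cong (_+_ (0ℤ * sumGaps B j G))
            (cong₂ _*_ (∑-matchWeight-swapped b d (λ e → ν₁ b (just e) (just f))) (sumGaps-Aentry-νB B (suc j) u v)) ⟩
  0ℤ * sumGaps B j G + ν₁ b (just d) (just f) * ((σ′ * s′) * z)
    ≡⟨ solve 5 (λ X n σ′ s′ z → con 0ℤ :* X :+ n :* ((σ′ :* s′) :* z) := (σ′ :* s′) :* (n :* z)) refl
               (sumGaps B j G) (ν₁ b (just d) (just f)) σ′ s′ z ⟩
  (σ′ * s′) * (ν₁ b (just d) (just f) * z) ∎
  where
  F = λ w → Aentry w (d ∷ u) * νB w (just f ∷ v)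
  G = λ w → Aentry w u * νB w v
  σ′ = -1ℤ ^ suc j
  s′ = + S (suc j) (gapBases v)
  z = νB (embed u) v

sumOver-allΣ-Aentry-νB : ∀ {ℓ} (B : Vec ℕ ℓ) (w v : ΔWord B) →
  sumOver (allΣ B) (λ u → Aentry w u * νB (embed u) v) ≡ (-1ℤ ^ gapCount w) * νB w v
sumOver-allΣ-Aentry-νB []      []      []      = refl
sumOver-allΣ-Aentry-νB (b ∷ B) (x ∷ w) (y ∷ v) = begin
  sumOver (allΣ (b ∷ B)) F
    ≡⟨ sumOver-allΣ-∷-factor B F φ G (λ d u → Aentry-∷-* x w d u _ _) ⟩
  (∑[ d < b ] φ d) * sumOver (allΣ B) G
    ≡⟨ cong (_*_ (∑[ d < b ] φ d)) (sumOver-allΣ-Aentry-νB B w v) ⟩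
  (∑[ d < b ] φ d) * (σ * z)
    ≡⟨ first-letter x ⟩
  (-1ℤ ^ gapCount (x ∷ w)) * νB (x ∷ w) (y ∷ v) ∎
  where
  F = λ u → Aentry (x ∷ w) u * νB (embed u) (y ∷ v)
  G = λ u → Aentry w u * νB (embed u) v
  φ = λ d → matchWeight x d * ν₁ b (just d) y
  σ = -1ℤ ^ gapCount w
  z = νB w v
  first-letter : ∀ x →
    (∑[ d < b ] (matchWeight x d * ν₁ b (just d) y)) * (σ * z) ≡ (-1ℤ ^ gapCount (x ∷ w)) * νB (x ∷ w) (y ∷ v)
  first-letter nothing = begin
    (∑[ d < b ] (1ℤ * ν₁ b (just d) y)) * (σ * z)
      ≡⟨ cong (_* (σ * z)) (trans (sum-cong-≗ (λ d → ZP.*-identityˡ (ν₁ b (just d) y))) (∑-ν₁ b y)) ⟩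
    (- ν₁ b nothing y) * (σ * z)
      ≡⟨ solve 3 (λ n σ z → (:- n) :* (σ :* z) := (con -1ℤ :* σ) :* (n :* z)) refl (ν₁ b nothing y) σ z ⟩
    (-1ℤ * σ) * (ν₁ b nothing y * z) ∎
  first-letter (just e) = begin
    (∑[ d < b ] (matchWeight (just e) d * ν₁ b (just d) y)) * (σ * z)
      ≡⟨ cong (_* (σ * z)) (∑-matchWeight b e (λ d → ν₁ b (just d) y)) ⟩
    ν₁ b (just e) y * (σ * z)
      ≡⟨ x*yz≈y*xz (ν₁ b (just e) y) σ z ⟩
    σ * (ν₁ b (just e) y * z) ∎

sumGaps-νB-orthogonal : ∀ {ℓ} (B : Vec ℕ ℓ) j (v v′ : ΔWord B) → v ≢ v′ →
  sumGaps B j (λ w → νB w v * νB w v′) ≡ 0ℤ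
sumGaps-νB-orthogonal []      j []      []       v≢v′ = ⊥-elim (v≢v′ refl)
sumGaps-νB-orthogonal (b ∷ B) j (x ∷ v) (y ∷ v′) xv≢yv′ with MP.≡-dec FP._≟_ x y
... | yes refl =
  sumGaps-∷-vanishʳ B j (λ w → νB w (x ∷ v) * νB w (x ∷ v′)) (λ x′ → ν₁ b x′ x * ν₁ b x′ x) G
    (λ x′ w → *-interchange (ν₁ b x′ x) (νB w v) (ν₁ b x′ x) (νB w v′))
    (λ j′ → sumGaps-νB-orthogonal B j′ v v′ (λ v≡v′ → xv≢yv′ (cong (x ∷_) v≡v′)))
  where
  G = λ w → νB w v * νB w v′
... | no x≢y =
  sumGaps-∷-vanishˡ B j (λ w → νB w (x ∷ v) * νB w (y ∷ v′)) (λ x′ → ν₁ b x′ x * ν₁ b x′ y) G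
    (λ x′ w → *-interchange (ν₁ b x′ x) (νB w v) (ν₁ b x′ y) (νB w v′))
    (ν₁-gap-orthogonal b x y x≢y) (∑-ν₁-orthogonal b x y x≢y)
  where
  G = λ w → νB w v * νB w v′

sumOver-allΣ-νB-orthogonal : ∀ {ℓ} (B : Vec ℕ ℓ) (v v′ : ΔWord B) → v ≢ v′ →
  sumOver (allΣ B) (λ u → νB (embed u) v * νB (embed u) v′) ≡ 0ℤ
sumOver-allΣ-νB-orthogonal []      []      []       v≢v′ = ⊥-elim (v≢v′ refl)
sumOver-allΣ-νB-orthogonal (b ∷ B) (x ∷ v) (y ∷ v′) xv≢yv′ =
  trans (sumOver-allΣ-∷-factor B (λ u → νB (embed u) (x ∷ v) * νB (embed u) (y ∷ v′)) φ G
           (λ d u → *-interchange (ν₁ b (just d) x) (νB (embed u) v) (ν₁ b (just d) y) (νB (embed u) v′)))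
        (vanish (MP.≡-dec FP._≟_ x y))
  where
  φ = λ d → ν₁ b (just d) x * ν₁ b (just d) y
  G = λ u → νB (embed u) v * νB (embed u) v′
  vanish : Dec (x ≡ y) → (∑[ d < b ] φ d) * sumOver (allΣ B) G ≡ 0ℤ
  vanish (yes refl) =
    *-zeroʳ-≡ (∑[ d < b ] φ d) (sumOver-allΣ-νB-orthogonal B v v′ (λ v≡v′ → xv≢yv′ (cong (x ∷_) v≡v′)))
  vanish (no x≢y) = *-zeroˡ-≡ (sumOver (allΣ B) G) (∑-ν₁-orthogonal b x y x≢y)

AT-xvec : ∀ {ℓ} (B : Vec ℕ ℓ) k (v : ΔWord B) (u : ΣWord B) →
  AT B k (xvec B k v) u ≡ + S (ℓ ∸ k) (gapBases v) * zvec B v u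
AT-xvec {ℓ} B k v u = begin
  sumOver (Vlist B k) (λ w → Aentry w u * (σ * νB w v))
    ≡⟨ sumOver-gapCount-filter B j _ ⟩
  sumGaps B j (λ w → Aentry w u * (σ * νB w v))
    ≡⟨ sumGaps-cong B j (λ w → x*yz≈y*xz (Aentry w u) σ (νB w v)) ⟩
  sumGaps B j (λ w → σ * (Aentry w u * νB w v))
    ≡⟨ sumGaps-*ˡ B j σ (λ w → Aentry w u * νB w v) ⟩
  σ * sumGaps B j (λ w → Aentry w u * νB w v)
    ≡⟨ cong (σ *_) (sumGaps-Aentry-νB B j u v) ⟩
  σ * ((σ * s) * z)
    ≡⟨ solve 3 (λ σ s z → σ :* ((σ :* s) :* z) := (σ :* σ) :* (s :* z)) refl σ s z ⟩
  (σ * σ) * (s * z)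
    ≡⟨ cong (_* (s * z)) (-1^n*-1^n≡1 j) ⟩
  1ℤ * (s * z)
    ≡⟨ ZP.*-identityˡ (s * z) ⟩
  s * z ∎
  where
  j = ℓ ∸ k
  σ = -1ℤ ^ j
  s = + S j (gapBases v)
  z = νB (embed u) v

Amul-zvec : ∀ {ℓ} (B : Vec ℕ ℓ) k (v w : ΔWord B) → InV k w → Amul B (zvec B v) w ≡ xvec B k v w
Amul-zvec B k v w gaps = trans (sumOver-allΣ-Aentry-νB B w v) (cong (λ g → (-1ℤ ^ g) * νB w v) gaps)

Amul-AT-xvec : ∀ {ℓ} (B : Vec ℕ ℓ) k (v w : ΔWord B) → InV k w →
  Amul B (AT B k (xvec B k v)) w ≡ + S (ℓ ∸ k) (gapBases v) * xvec B k v w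
Amul-AT-xvec {ℓ} B k v w gaps = begin
  sumOver (allΣ B) (λ u → Aentry w u * AT B k (xvec B k v) u)
    ≡⟨ sumOver-cong (allΣ B) (λ u → cong (Aentry w u *_) (AT-xvec B k v u)) ⟩
  sumOver (allΣ B) (λ u → Aentry w u * (s * zvec B v u))
    ≡⟨ sumOver-cong (allΣ B) (λ u → x*yz≈y*xz (Aentry w u) s (zvec B v u)) ⟩
  sumOver (allΣ B) (λ u → s * (Aentry w u * zvec B v u))
    ≡⟨ sumOver-*ˡ (allΣ B) s (λ u → Aentry w u * zvec B v u) ⟩
  s * Amul B (zvec B v) w
    ≡⟨ cong (s *_) (Amul-zvec B k v w gaps) ⟩
  s * xvec B k v w ∎
  where
  s = + S (ℓ ∸ k) (gapBases v)

AT-Amul-zvec : ∀ {ℓ} (B : Vec ℕ ℓ) k (v : ΔWord B) (u : ΣWord B) →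
  AT B k (Amul B (zvec B v)) u ≡ + S (ℓ ∸ k) (gapBases v) * zvec B v u
AT-Amul-zvec {ℓ} B k v u =
  trans (sumOver-filter-cong (λ w → gapCount w N.≟ (ℓ ∸ k)) (allΔ B)
           (λ w gaps → cong (Aentry w u *_) (Amul-zvec B k v w gaps)))
        (AT-xvec B k v u)

innerV-xvec-orthogonal : ∀ {ℓ} (B : Vec ℕ ℓ) k (v v′ : ΔWord B) → v ≢ v′ →
  innerV B k (xvec B k v) (xvec B k v′) ≡ + 0
innerV-xvec-orthogonal {ℓ} B k v v′ v≢v′ = begin
  sumOver (Vlist B k) (λ w → (σ * νB w v) * (σ * νB w v′))
    ≡⟨ sumOver-gapCount-filter B j _ ⟩
  sumGaps B j (λ w → (σ * νB w v) * (σ * νB w v′))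
    ≡⟨ sumGaps-cong B j (λ w → *-interchange σ (νB w v) σ (νB w v′)) ⟩
  sumGaps B j (λ w → (σ * σ) * (νB w v * νB w v′))
    ≡⟨ sumGaps-*ˡ B j (σ * σ) (λ w → νB w v * νB w v′) ⟩
  (σ * σ) * sumGaps B j (λ w → νB w v * νB w v′)
    ≡⟨ *-zeroʳ-≡ (σ * σ) (sumGaps-νB-orthogonal B j v v′ v≢v′) ⟩
  0ℤ ∎
  where
  j = ℓ ∸ k
  σ = -1ℤ ^ j

-- The identities hold for every word v′ and every base.
proposition5 : (ℓ : ℕ) → 1 ≤ ℓ → (n k : ℕ) → n ≤ k → k ≤ ℓ →
    (B : Vec ℕ ℓ) → All (2 ≤_) B →
    (v' : ΔWord B) → InV' n v' →
    (∀ (u : ΣWord B) → AT B k (xvec B k v') u ≡ (+ S (ℓ ∸ k) (gapBases v')) * zvec B v' u)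
    × (∀ (w : ΔWord B) → InV k w → Amul B (zvec B v') w ≡ xvec B k v' w)
    × (∀ (w : ΔWord B) → InV k w →
         Amul B (AT B k (xvec B k v')) w ≡ (+ S (ℓ ∸ k) (gapBases v')) * xvec B k v' w)
    × (∀ (u : ΣWord B) →
         AT B k (Amul B (zvec B v')) u ≡ (+ S (ℓ ∸ k) (gapBases v')) * zvec B v' u)
    × (∀ (n₁ n₂ : ℕ) → n₁ ≤ k → n₂ ≤ k → (v u : ΔWord B) → InV' n₁ v → InV' n₂ u → v ≢ u →
         innerV B k (xvec B k v) (xvec B k u) ≡ + 0)
    × (∀ (n₁ n₂ : ℕ) → n₁ ≤ k → n₂ ≤ k → (v u : ΔWord B) → InV' n₁ v → InV' n₂ u → v ≢ u →
         innerΣ B (zvec B v) (zvec B u) ≡ + 0)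
proposition5 ℓ _ n k _ _ B _ v' _ =
  AT-xvec B k v' ,
  Amul-zvec B k v' ,
  Amul-AT-xvec B k v' ,
  AT-Amul-zvec B k v' ,
  (λ _ _ _ _ v u _ _ v≢u → innerV-xvec-orthogonal B k v u v≢u) ,
  (λ _ _ _ _ v u _ _ v≢u → sumOver-allΣ-νB-orthogonal B v u v≢u)
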